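{- Let $(\mathcal{C},\otimes,I)$ be a small productive symmetric monoidal category. Then the final coalgebra of the endofunctor $\Phi$ on $[(\mathcal{C}^{\mathbb{N}})^{op}\times\mathcal{C}^{\mathbb{N}},\mathbf{Set}]$, $$\Phi(Q)(\mathbf{X},\mathbf{Y})=\int^{M\in\mathcal{C}}\mathcal{C}(X_0,M\otimes Y_0)\times Q(M\cdot\mathbf{X}^+,\mathbf{Y}^+),$$ exists, and it is given by the set of observational sequences $$\mathrm{oSeq}(\mathbf{X},\mathbf{Y})=\Big(\int^{(M_n)\in\mathcal{C}^{\mathbb{N}}}\prod_{i=0}^{\infty}\mathcal{C}(M_{i-1}\otimes X_i,M_i\otimes Y_i)\Big)\Big/\approx,$$ that is, dinatural sequences quotiented by observational equivalence. In particular, the final fixpoint of the equation $Q(\mathbf{X},\mathbf{Y})\cong\int^{M}\mathcal{C}(X_0,M\otimes Y_0)\times Q(M\cdot\mathbf{X}^+,\mathbf{Y}^+)$ is $\mathrm{oSeq}$.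
   Context: $\mathcal{C}^{\mathbb{N}}$ is the category of sequences $\mathbf{X}=(X_0,X_1,\dots)$ of objects of $\mathcal{C}$ with componentwise morphisms; $\mathbf{X}^+=(X_1,X_2,\dots)$ and $M\cdot\mathbf{X}=(M\otimes X_0,X_1,\dots)$. Composition is written in diagrammatic order $;$ and associators/unitors are suppressed. $M_{ -1}:=I$. Dinatural sequences: sequences $(f_n\colon M_{n-1}\otimes X_n\to M_n\otimes Y_n)_n$ modulo the equivalence generated by $(f_n;(r_n\otimes1))_n\sim((r_{n-1}\otimes1);f_n)_n$ for $f_n\colon M_{n-1}\otimes X_n\to N_n\otimes Y_n$, $r_n\colon N_n\to M_n$, $r_{ -1}=\mathrm{id}_I$. For $n\in\mathbb{N}$, $\mathrm{Stage}_n(\mathbf{X},\mathbf{Y})=\int^{M_0,\dots,M_n}\prod_{i=0}^n\mathcal{C}(M_{i-1}\otimes X_i,M_i\otimes Y_i)$: tuples $(f_0,\dots,f_n)$ modulo the analogous relation (morphisms $r_i$ may slide between consecutive components, including $r_n$ after $f_n$); its class is written $\langle f_0|\dots|f_n\rangle$. Two dinatural sequences $(f_n)$, $(g_n)$ are observationally equivalent, $f\approx g$, if $\langle f_0|\dots|f_n\rangle=\langle g_0|\dots|g_n\rangle$ for every $n$. Productive: for any objects $P,Q$ write $\langle h\rangle$ for the class of $h\colon P\to W\otimes Q$ in $\int^{W}\mathcal{C}(P,W\otimes Q)$ (the quotient of morphisms $P\to W\otimes Q$, $W$ varying, by the equivalence generated by $h;(r\otimes 1_Q)\sim h$). $\mathcal{C}$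 is productive if for all objects $X_0,Y_0$, every class $\alpha\in\int^M\mathcal{C}(X_0,M\otimes Y_0)$ is terminating: there exist an object $M_0$, a morphism $\alpha_0\colon X_0\to M_0\otimes Y_0$ and, for each representative $\alpha_i\colon X_0\to M_i\otimes Y_0$ of $\alpha$, a morphism $s_i\colon M_0\to M_i$ with $\alpha_i=\alpha_0;(s_i\otimes1_{Y_0})$, such that for all objects $A,B,U,V$ and morphisms $u\colon M_i\otimes A\to U\otimes B$, $v\colon M_j\otimes A\to V\otimes B$, the equality $\langle(\alpha_i\otimes1_A);(u\otimes1_{Y_0})\rangle=\langle(\alpha_j\otimes1_A);(v\otimes1_{Y_0})\rangle$ in $\int^W\mathcal{C}(X_0\otimes A,W\otimes B\otimes Y_0)$ (symmetries inserted as needed) implies $\langle(s_i\otimes1_A);u\rangle=\langle(s_j\otimes1_A);v\rangle$ in $\int^W\mathcal{C}(M_0\otimes A,W\otimes B)$. -}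

module Defs where

open import Level using (0ℓ)
open import Data.Nat using (ℕ; zero; suc)
open import Data.Product using (Σ; _×_; _,_; proj₁)
open import Relation.Binary.Core using (Rel)
open import Relation.Binary.Structures using (IsEquivalence)
open import Relation.Binary.PropositionalEquality using (_≡_)
open import Relation.Binary.Construct.Closure.Equivalence using (EqClosure)

-- Composition is diagrammatic: f ⨾ g means "first f, then g".

record SymMonCat : Set₁ where
  infixr 9 _⨾_
  infixr 10 _⊗₁_
  infixr 10 _⊗₀_
  field
    Obj   : Set
    Hom   : Obj → Obj → Set
    id    : ∀ {A} → Hom A A
    _⨾_   : ∀ {A B C} → Hom A B → Hom B C → Hom A C
    idˡ   : ∀ {A B} (f : Hom A B) → id ⨾ f ≡ f
    idʳ   : ∀ {A B} (f : Hom A B) → f ⨾ id ≡ f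
    assoc : ∀ {A B C D} (f : Hom A B) (g : Hom B C) (h : Hom C D) →
            (f ⨾ g) ⨾ h ≡ f ⨾ (g ⨾ h)

    _⊗₀_  : Obj → Obj → Obj
    _⊗₁_  : ∀ {A B C D} → Hom A B → Hom C D → Hom (A ⊗₀ C) (B ⊗₀ D)
    ⊗-id  : ∀ {A B} → id {A} ⊗₁ id {B} ≡ id
    ⊗-⨾   : ∀ {A B C D E F} (f : Hom A B) (g : Hom B C) (h : Hom D E) (k : Hom E F) →
            (f ⨾ g) ⊗₁ (h ⨾ k) ≡ (f ⊗₁ h) ⨾ (g ⊗₁ k)
    I     : Obj

    asc    : ∀ {A B C} → Hom ((A ⊗₀ B) ⊗₀ C) (A ⊗₀ (B ⊗₀ C))
    asc⁻¹  : ∀ {A B C} → Hom (A ⊗₀ (B ⊗₀ C)) ((A ⊗₀ B) ⊗₀ C)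
    asc-isoˡ : ∀ {A B C} → asc {A} {B} {C} ⨾ asc⁻¹ ≡ id
    asc-isoʳ : ∀ {A B C} → asc⁻¹ ⨾ asc {A} {B} {C} ≡ id
    asc-nat  : ∀ {A A' B B' C C'} (f : Hom A A') (g : Hom B B') (h : Hom C C') →
               ((f ⊗₁ g) ⊗₁ h) ⨾ asc ≡ asc ⨾ (f ⊗₁ (g ⊗₁ h))

    lu     : ∀ {A} → Hom (I ⊗₀ A) A
    lu⁻¹   : ∀ {A} → Hom A (I ⊗₀ A)
    lu-isoˡ : ∀ {A} → lu {A} ⨾ lu⁻¹ ≡ id
    lu-isoʳ : ∀ {A} → lu⁻¹ ⨾ lu {A} ≡ id
    lu-nat  : ∀ {A B} (f : Hom A B) → (id {I} ⊗₁ f) ⨾ lu ≡ lu ⨾ f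

    ru     : ∀ {A} → Hom (A ⊗₀ I) A
    ru⁻¹   : ∀ {A} → Hom A (A ⊗₀ I)
    ru-isoˡ : ∀ {A} → ru {A} ⨾ ru⁻¹ ≡ id
    ru-isoʳ : ∀ {A} → ru⁻¹ ⨾ ru {A} ≡ id
    ru-nat  : ∀ {A B} (f : Hom A B) → (f ⊗₁ id {I}) ⨾ ru ≡ ru ⨾ f

    σ       : ∀ {A B} → Hom (A ⊗₀ B) (B ⊗₀ A)
    σ-nat   : ∀ {A A' B B'} (f : Hom A A') (g : Hom B B') → (f ⊗₁ g) ⨾ σ ≡ σ ⨾ (g ⊗₁ f)
    σ-inv   : ∀ {A B} → σ {A} {B} ⨾ σ ≡ id

    pentagon : ∀ {A B C D} →
      (asc {A} {B} {C} ⊗₁ id {D}) ⨾ asc ⨾ (id ⊗₁ asc) ≡ asc ⨾ asc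
    triangle : ∀ {A B} → asc {A} {I} {B} ⨾ (id ⊗₁ lu) ≡ ru ⊗₁ id
    hexagon  : ∀ {A B C} →
      asc {A} {B} {C} ⨾ σ ⨾ asc ≡ (σ ⊗₁ id) ⨾ asc ⨾ (id ⊗₁ σ)

module Theory (C : SymMonCat) where
  open SymMonCat C

  -- Productivity.
  -- Cls P Q : representatives of ∫^W C(P, W ⊗ Q); _≈ᶜ_ : equality of
  -- classes (equivalence generated by h ⨾ (r ⊗ 1) ∼ h).

  Cls : Obj → Obj → Set
  Cls P Q = Σ Obj λ W → Hom P (W ⊗₀ Q)

  data Slide1 {P Q : Obj} : Cls P Q → Cls P Q → Set where
    slide : ∀ {W W'} (h : Hom P (W ⊗₀ Q)) (r : Hom W W') →
            Slide1 (W' , h ⨾ (r ⊗₁ id)) (W , h)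

  _≈ᶜ_ : ∀ {P Q} → Cls P Q → Cls P Q → Set
  _≈ᶜ_ = EqClosure Slide1

  -- (α_i ⊗ 1_A) ; (u ⊗ 1_{Y0}) with the symmetry/associators inserted:
  -- X0⊗A → (Mi⊗Y0)⊗A → Mi⊗(Y0⊗A) → Mi⊗(A⊗Y0) → (Mi⊗A)⊗Y0 → (U⊗B)⊗Y0 → U⊗(B⊗Y0)
  embed : ∀ {X0 Y0 Mi A B U} → Hom X0 (Mi ⊗₀ Y0) → Hom (Mi ⊗₀ A) (U ⊗₀ B) →
          Hom (X0 ⊗₀ A) (U ⊗₀ (B ⊗₀ Y0))
  embed {Y0 = Y0} {A = A} αi u =
    (αi ⊗₁ id {A}) ⨾ asc ⨾ (id ⊗₁ σ) ⨾ asc⁻¹ ⨾ (u ⊗₁ id {Y0}) ⨾ asc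

  record Terminating (X0 Y0 W : Obj) (h : Hom X0 (W ⊗₀ Y0)) : Set where
    field
      M0 : Obj
      α0 : Hom X0 (M0 ⊗₀ Y0)
      s  : ∀ {Mi} (αi : Hom X0 (Mi ⊗₀ Y0)) → (Mi , αi) ≈ᶜ (W , h) → Hom M0 Mi
      s-irrel : ∀ {Mi} (αi : Hom X0 (Mi ⊗₀ Y0)) (p q : (Mi , αi) ≈ᶜ (W , h)) →
                s αi p ≡ s αi q
      factor : ∀ {Mi} (αi : Hom X0 (Mi ⊗₀ Y0)) (p : (Mi , αi) ≈ᶜ (W , h)) →
               αi ≡ α0 ⨾ (s αi p ⊗₁ id)
      reflect : ∀ {Mi Mj} (αi : Hom X0 (Mi ⊗₀ Y0)) (pi : (Mi , αi) ≈ᶜ (W , h))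
                  (αj : Hom X0 (Mj ⊗₀ Y0)) (pj : (Mj , αj) ≈ᶜ (W , h))
                  {A B U V : Obj} (u : Hom (Mi ⊗₀ A) (U ⊗₀ B)) (v : Hom (Mj ⊗₀ A) (V ⊗₀ B)) →
                _≈ᶜ_ {X0 ⊗₀ A} {B ⊗₀ Y0} (U , embed αi u) (V , embed αj v) →
                _≈ᶜ_ {M0 ⊗₀ A} {B} (U , (s αi pi ⊗₁ id) ⨾ u) (V , (s αj pj ⊗₁ id) ⨾ v)

  Productive : Set
  Productive = ∀ (X0 Y0 W : Obj) (h : Hom X0 (W ⊗₀ Y0)) → Terminating X0 Y0 W h

  Obj∞ : Set
  Obj∞ = ℕ → Obj

  -- a morphism of C^ℕ is a sequence of morphisms (wrapped in a record
  -- only so that its source and target can be inferred)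
  record Hom∞ (X Y : Obj∞) : Set where
    constructor mk∞
    field _$_ : (n : ℕ) → Hom (X n) (Y n)
  open Hom∞ public

  id∞ : ∀ {X} → Hom∞ X X
  id∞ = mk∞ λ n → id

  _⨾∞_ : ∀ {X Y Z} → Hom∞ X Y → Hom∞ Y Z → Hom∞ X Z
  f ⨾∞ g = mk∞ λ n → (f $ n) ⨾ (g $ n)

  _⁺ : Obj∞ → Obj∞
  (X ⁺) n = X (suc n)

  _⁺₁ : ∀ {X Y} → Hom∞ X Y → Hom∞ (X ⁺) (Y ⁺)
  f ⁺₁ = mk∞ λ n → f $ suc n

  _·_ : Obj → Obj∞ → Obj∞
  (M · X) zero    = M ⊗₀ X zero
  (M · X) (suc n) = X (suc n)

  ·₁-comp : ∀ {M N X Y} → Hom M N → Hom∞ X Y → (n : ℕ) → Hom ((M · X) n) ((N · Y) n)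
  ·₁-comp r f zero    = r ⊗₁ (f $ zero)
  ·₁-comp r f (suc n) = f $ suc n

  _·₁_ : ∀ {M N X Y} → Hom M N → Hom∞ X Y → Hom∞ (M · X) (N · Y)
  r ·₁ f = mk∞ (·₁-comp r f)

  -- Functors (C^ℕ)^op × C^ℕ → Set, with Set modelled by setoids.

  record RawProf : Set₁ where
    field
      F   : Obj∞ → Obj∞ → Set
      _≈_ : ∀ {X Y} → F X Y → F X Y → Set
      act : ∀ {X X' Y Y'} → Hom∞ X' X → Hom∞ Y Y' → F X Y → F X' Y'

  record IsProfunctor (P : RawProf) : Set where
    open RawProf P
    field
      isEquiv  : ∀ {X Y} → IsEquivalence (_≈_ {X} {Y})
      act-cong : ∀ {X X' Y Y'} {f f' : Hom∞ X' X} {g g' : Hom∞ Y Y'} {x y : F X Y} →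
                 (∀ n → f $ n ≡ f' $ n) → (∀ n → g $ n ≡ g' $ n) → x ≈ y → act f g x ≈ act f' g' y
      act-id   : ∀ {X Y} (x : F X Y) → act id∞ id∞ x ≈ x
      act-comp : ∀ {X X' X'' Y Y' Y''} (f : Hom∞ X' X) (f' : Hom∞ X'' X')
                   (g : Hom∞ Y Y') (g' : Hom∞ Y' Y'') (x : F X Y) →
                 act (f' ⨾∞ f) (g ⨾∞ g') x ≈ act f' g' (act f g x)

  module _ (Q : RawProf) where
    open RawProf Q

    -- representatives (M , h , q) of elements of the coend
    record ΦObj (X Y : Obj∞) : Set where
      constructor ⟨_,_,_⟩
      field
        M : Obj
        h : Hom (X zero) (M ⊗₀ Y zero)
        q : F (M · (X ⁺)) (Y ⁺)

    data ΦGen {X Y : Obj∞} : ΦObj X Y → ΦObj X Y → Set where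
      slide : ∀ {M N} (h : Hom (X zero) (M ⊗₀ Y zero)) (r : Hom M N)
                (q : F (N · (X ⁺)) (Y ⁺)) →
              ΦGen ⟨ N , h ⨾ (r ⊗₁ id) , q ⟩ ⟨ M , h , act (r ·₁ id∞) id∞ q ⟩
      cong-q : ∀ {M} (h : Hom (X zero) (M ⊗₀ Y zero)) {q q' : F (M · (X ⁺)) (Y ⁺)} →
               q ≈ q' → ΦGen ⟨ M , h , q ⟩ ⟨ M , h , q' ⟩

    _≈Φ_ : ∀ {X Y} → ΦObj X Y → ΦObj X Y → Set
    _≈Φ_ = EqClosure ΦGen

    Φact : ∀ {X X' Y Y'} → Hom∞ X' X → Hom∞ Y Y' → ΦObj X Y → ΦObj X' Y'
    Φact f g ⟨ M , h , q ⟩ = ⟨ M , (f $ zero) ⨾ h ⨾ (id ⊗₁ (g $ zero)) , act (id ·₁ (f ⁺₁)) (g ⁺₁) q ⟩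

  Φmap : (A B : RawProf) → (∀ {X Y} → RawProf.F A X Y → RawProf.F B X Y) →
         ∀ {X Y} → ΦObj A X Y → ΦObj B X Y
  Φmap A B u ⟨ M , h , q ⟩ = ⟨ M , h , u q ⟩

  CoalgStr : RawProf → Set
  CoalgStr A = ∀ {X Y} → RawProf.F A X Y → ΦObj A X Y

  record IsCoalg (A : RawProf) (ξ : CoalgStr A) : Set where
    open RawProf A
    field
      ξ-cong : ∀ {X Y} {x y : F X Y} → x ≈ y → _≈Φ_ A (ξ x) (ξ y)
      ξ-nat  : ∀ {X X' Y Y'} (f : Hom∞ X' X) (g : Hom∞ Y Y') (x : F X Y) →
               _≈Φ_ A (ξ (act f g x)) (Φact A f g (ξ x))

  record IsNat (A B : RawProf) (u : ∀ {X Y} → RawProf.F A X Y → RawProf.F B X Y) : Set where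
    module A = RawProf A
    module B = RawProf B
    field
      u-cong : ∀ {X Y} {x y : A.F X Y} → A._≈_ x y → B._≈_ (u x) (u y)
      u-nat  : ∀ {X X' Y Y'} (f : Hom∞ X' X) (g : Hom∞ Y Y') (x : A.F X Y) →
               B._≈_ (u (A.act f g x)) (B.act f g (u x))

  IsCoalgHom : (A B : RawProf) (ξA : CoalgStr A) (ξB : CoalgStr B) →
               (∀ {X Y} → RawProf.F A X Y → RawProf.F B X Y) → Set
  IsCoalgHom A B ξA ξB u =
    ∀ {X Y} (x : RawProf.F A X Y) → _≈Φ_ B (ξB (u x)) (Φmap A B u (ξA x))

  IsFinal : (B : RawProf) → CoalgStr B → Set₁
  IsFinal B ξB =
    (A : RawProf) → IsProfunctor A → (ξA : CoalgStr A) → IsCoalg A ξA →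
    Σ (∀ {X Y} → RawProf.F A X Y → RawProf.F B X Y) λ u →
      IsNat A B u × IsCoalgHom A B ξA ξB u ×
      ((v : ∀ {X Y} → RawProf.F A X Y → RawProf.F B X Y) →
        IsNat A B v → IsCoalgHom A B ξA ξB v →
        ∀ {X Y} (x : RawProf.F A X Y) → RawProf._≈_ B (u x) (v x))

  -- M_{n-1}, with M_{-1} := P
  prevP : Obj → (ℕ → Obj) → ℕ → Obj
  prevP P M zero    = P
  prevP P M (suc n) = M n

  DSeqFrom : Obj → Obj∞ → Obj∞ → Set
  DSeqFrom P X Y = Σ (ℕ → Obj) λ M → (n : ℕ) → Hom (prevP P M n ⊗₀ X n) (M n ⊗₀ Y n)

  tailSeq : ∀ {P X Y} (s : DSeqFrom P X Y) → DSeqFrom (proj₁ s zero) (X ⁺) (Y ⁺)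
  tailSeq (M , f) = (λ k → M (suc k)) , λ { zero → f (suc zero) ; (suc k) → f (suc (suc k)) }

  Chain : ℕ → Obj → Obj∞ → Obj∞ → Set
  Chain zero    P X Y = Σ Obj λ M → Hom (P ⊗₀ X zero) (M ⊗₀ Y zero)
  Chain (suc n) P X Y = Σ Obj λ M → Hom (P ⊗₀ X zero) (M ⊗₀ Y zero) × Chain n M (X ⁺) (Y ⁺)

  pre : ∀ n {P P' X Y} → Hom P' P → Chain n P X Y → Chain n P' X Y
  pre zero    r (M , h)     = M , (r ⊗₁ id) ⨾ h
  pre (suc n) r (M , h , c) = M , (r ⊗₁ id) ⨾ h , c

  data StageStep : (n : ℕ) (P : Obj) (X Y : Obj∞) → Chain n P X Y → Chain n P X Y → Set where
    last   : ∀ {P X Y M N} (h : Hom (P ⊗₀ X zero) (N ⊗₀ Y zero)) (r : Hom N M) →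
             StageStep zero P X Y (M , h ⨾ (r ⊗₁ id)) (N , h)
    mid    : ∀ {n P X Y M N} (h : Hom (P ⊗₀ X zero) (N ⊗₀ Y zero)) (r : Hom N M)
               (c : Chain n M (X ⁺) (Y ⁺)) →
             StageStep (suc n) P X Y (M , h ⨾ (r ⊗₁ id) , c) (N , h , pre n r c)
    deeper : ∀ {n P X Y M} (h : Hom (P ⊗₀ X zero) (M ⊗₀ Y zero))
               {c c' : Chain n M (X ⁺) (Y ⁺)} →
             StageStep n M (X ⁺) (Y ⁺) c c' →
             StageStep (suc n) P X Y (M , h , c) (M , h , c')

  StageEq : ∀ n X Y → Chain n I X Y → Chain n I X Y → Set
  StageEq n X Y = EqClosure (StageStep n I X Y)

  trunc : ∀ n {P X Y} → DSeqFrom P X Y → Chain n P X Y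
  trunc zero    (M , f) = M zero , f zero
  trunc (suc n) (M , f) = M zero , f zero , trunc n (tailSeq (M , f))

  oSeqF : Obj∞ → Obj∞ → Set
  oSeqF X Y = DSeqFrom I X Y

  _≈ₒ_ : ∀ {X Y} → oSeqF X Y → oSeqF X Y → Set
  _≈ₒ_ {X} {Y} a b = ∀ n → StageEq n X Y (trunc n a) (trunc n b)

  oSeqAct : ∀ {X X' Y Y'} → Hom∞ X' X → Hom∞ Y Y' → oSeqF X Y → oSeqF X' Y'
  oSeqAct f g (M , h) = M , λ n → (id ⊗₁ (f $ n)) ⨾ h n ⨾ (id ⊗₁ (g $ n))

  oSeq : RawProf
  oSeq = record { F = oSeqF ; _≈_ = _≈ₒ_ ; act = oSeqAct }

  oSeqξ : CoalgStr oSeq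
  oSeqξ (M , h) =
    ⟨ M zero , lu⁻¹ ⨾ h zero ,
      ((λ k → M (suc k)) , λ { zero → lu ⨾ h (suc zero) ; (suc k) → h (suc (suc k)) }) ⟩

{-# OPTIONS --safe #-}
-- A Φ-coalgebra (A, ξ) unfolds every element x into a dinatural sequence: its first component is the
-- middle morphism of ξ x, the rest is the unfolding of the remainder of ξ x. Observational equivalence
-- is tested stage by stage, and stage n+1 of an element of Φ(oSeq) only involves stage n of its
-- remainder; so induction on the stage shows that the unfolding is natural, respects the equality of A,
-- is a coalgebra morphism, and agrees stagewise with every other coalgebra morphism into oSeq.
--
-- The real work is that the structure map (fₙ)ₙ ↦ ⟨f₀ | (f₁, f₂, …)⟩ of oSeq respects ≈. A chain
-- (f₀, …, fₙ) has a composite P ⊗ X₀ ⊗ … ⊗ Xₙ → W ⊗ Yₙ ⊗ … ⊗ Y₀ whose class in ∫^W is invariant under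
-- the moves of Stageₙ. If two sequences have equal composites at every stage, their first components
-- are equal classes; productivity factors both through one α₀, and its reflection property transfers
-- the equality of composites to the tails precomposed with the factorising maps. By induction these
-- tails are then equal at every stage, which is what the coend Φ(oSeq) needs after sliding along α₀.
module Submission where

open import Defs
open import Data.Nat using (ℕ; zero; suc)
open import Data.Product using (Σ; _×_; _,_; proj₁; proj₂)
open import Data.Unit using (⊤; tt)
open import Relation.Binary.Structures using (IsEquivalence)
open import Relation.Binary.PropositionalEquality
open import Relation.Binary.Construct.Closure.Equivalence as EqClosure
  using (EqClosure; gmap; gfold; return)
open import Relation.Binary.Construct.Closure.ReflexiveTransitive using (ε; _◅◅_)

module MonoidalLemmas (C : SymMonCat) where
  open SymMonCat C
  open ≡-Reasoning

  extendʳ : ∀ {A B B′ D E} {a : Hom A B} {b : Hom B D} {c : Hom A B′} {d : Hom B′ D} {k : Hom D E} →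
            a ⨾ b ≡ c ⨾ d → a ⨾ (b ⨾ k) ≡ c ⨾ (d ⨾ k)
  extendʳ {a = a} {b} {c} {d} {k} e = begin
    a ⨾ (b ⨾ k)  ≡⟨ assoc a b k ⟨
    (a ⨾ b) ⨾ k  ≡⟨ cong (_⨾ k) e ⟩
    (c ⨾ d) ⨾ k  ≡⟨ assoc c d k ⟩
    c ⨾ (d ⨾ k)  ∎

  cancelˡ : ∀ {A B D} {f : Hom A B} {g : Hom B A} {k : Hom A D} → f ⨾ g ≡ id → f ⨾ (g ⨾ k) ≡ k
  cancelˡ {f = f} {g} {k} e = begin
    f ⨾ (g ⨾ k)  ≡⟨ assoc f g k ⟨
    (f ⨾ g) ⨾ k  ≡⟨ cong (_⨾ k) e ⟩
    id ⨾ k       ≡⟨ idˡ k ⟩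
    k            ∎

  inverse-natural : ∀ {A A′ B B′} {i : Hom A B} {j : Hom B A} {i′ : Hom A′ B′} {j′ : Hom B′ A′}
                      {f : Hom A A′} {g : Hom B B′} →
                    j ⨾ i ≡ id → i′ ⨾ j′ ≡ id → f ⨾ i′ ≡ i ⨾ g → j ⨾ f ≡ g ⨾ j′
  inverse-natural {i = i} {j} {i′} {j′} {f} {g} j⨾i i′⨾j′ natural = begin
    j ⨾ f                ≡⟨ cong (j ⨾_) (idʳ f) ⟨
    j ⨾ (f ⨾ id)         ≡⟨ cong (λ z → j ⨾ (f ⨾ z)) i′⨾j′ ⟨
    j ⨾ (f ⨾ (i′ ⨾ j′))  ≡⟨ cong (j ⨾_) (extendʳ natural) ⟩
    j ⨾ (i ⨾ (g ⨾ j′))   ≡⟨ cancelˡ j⨾i ⟩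
    g ⨾ j′               ∎

  ⊗id-⨾ : ∀ {A B D E} (f : Hom A B) (g : Hom B D) → (f ⨾ g) ⊗₁ id {E} ≡ (f ⊗₁ id) ⨾ (g ⊗₁ id)
  ⊗id-⨾ f g = trans (cong ((f ⨾ g) ⊗₁_) (sym (idˡ id))) (⊗-⨾ f g id id)

  id⊗-⨾ : ∀ {A B D E} (f : Hom A B) (g : Hom B D) → id {E} ⊗₁ (f ⨾ g) ≡ (id ⊗₁ f) ⨾ (id ⊗₁ g)
  id⊗-⨾ f g = trans (cong (_⊗₁ (f ⨾ g)) (sym (idˡ id))) (⊗-⨾ id id f g)

  ⊗-interchange : ∀ {A B D E} (f : Hom A B) (g : Hom D E) → (f ⊗₁ id) ⨾ (id ⊗₁ g) ≡ (id ⊗₁ g) ⨾ (f ⊗₁ id)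
  ⊗-interchange f g = begin
    (f ⊗₁ id) ⨾ (id ⊗₁ g)  ≡⟨ ⊗-⨾ f id id g ⟨
    (f ⨾ id) ⊗₁ (id ⨾ g)   ≡⟨ cong₂ _⊗₁_ (trans (idʳ f) (sym (idˡ f))) (trans (idˡ g) (sym (idʳ g))) ⟩
    (id ⨾ f) ⊗₁ (g ⨾ id)   ≡⟨ ⊗-⨾ id f g id ⟩
    (id ⊗₁ g) ⨾ (f ⊗₁ id)  ∎

  id⊗id-conjugate : ∀ {A B D E} (h : Hom (A ⊗₀ B) (D ⊗₀ E)) → (id ⊗₁ id) ⨾ h ⨾ (id ⊗₁ id) ≡ h
  id⊗id-conjugate h = trans (cong₂ (λ a b → a ⨾ h ⨾ b) ⊗-id ⊗-id) (trans (idˡ _) (idʳ h))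

  lu-pull : ∀ {A B D E} (f : Hom A B) (h : Hom B D) (k : Hom D E) →
            (id ⊗₁ f) ⨾ (lu ⨾ h) ⨾ k ≡ lu ⨾ (f ⨾ h ⨾ k)
  lu-pull f h k = trans (cong ((id ⊗₁ f) ⨾_) (assoc lu h k)) (extendʳ (lu-nat f))

  lu⁻¹-nat : ∀ {A B} (f : Hom A B) → lu⁻¹ ⨾ (id ⊗₁ f) ≡ f ⨾ lu⁻¹
  lu⁻¹-nat f = inverse-natural lu-isoʳ lu-isoˡ (lu-nat f)

  lu⁻¹-pull : ∀ {A B D E} (f : Hom A B) (h : Hom (I ⊗₀ B) D) (k : Hom D E) →
              lu⁻¹ ⨾ (id ⊗₁ f) ⨾ h ⨾ k ≡ f ⨾ (lu⁻¹ ⨾ h) ⨾ k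
  lu⁻¹-pull f h k = trans (extendʳ (lu⁻¹-nat f)) (cong (f ⨾_) (sym (assoc _ _ _)))

  lu-slide : ∀ {A B D E} (r : Hom A B) (h : Hom B (D ⊗₀ E)) →
             (id ⊗₁ r) ⨾ (lu ⨾ h) ⨾ (id ⊗₁ id) ≡ lu ⨾ (r ⨾ h)
  lu-slide r h = trans (lu-pull r h (id ⊗₁ id)) (cong (λ z → lu ⨾ r ⨾ z) (trans (cong (h ⨾_) ⊗-id) (idʳ h)))

  lu⁻¹-slide : ∀ {A B D E} (r : Hom A B) (h : Hom (I ⊗₀ B) (D ⊗₀ E)) →
               lu⁻¹ ⨾ (id ⊗₁ r) ⨾ h ⨾ (id ⊗₁ id) ≡ r ⨾ (lu⁻¹ ⨾ h)
  lu⁻¹-slide r h = trans (lu⁻¹-pull r h (id ⊗₁ id)) (cong (r ⨾_) (trans (cong ((lu⁻¹ ⨾ h) ⨾_) ⊗-id) (idʳ _)))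

  asc-natˡ : ∀ {M N A B} (r : Hom N M) → ((r ⊗₁ id {A}) ⊗₁ id {B}) ⨾ asc ≡ asc ⨾ (r ⊗₁ id)
  asc-natˡ r = trans (asc-nat r id id) (cong (λ z → asc ⨾ (r ⊗₁ z)) ⊗-id)

  asc⁻¹-natˡ : ∀ {M N A B} (r : Hom N M) → asc⁻¹ ⨾ ((r ⊗₁ id {A}) ⊗₁ id {B}) ≡ (r ⊗₁ id) ⨾ asc⁻¹
  asc⁻¹-natˡ r = inverse-natural asc-isoʳ asc-isoˡ (asc-natˡ r)

module ObservationalSequences (C : SymMonCat) where
  open SymMonCat C
  open Theory C
  open MonoidalLemmas C
  open ≡-Reasoning

  ≡⇒≈ : ∀ {A : Set} {R : A → A → Set} {x y : A} → x ≡ y → EqClosure R x y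
  ≡⇒≈ refl = ε

  _▷_ : ∀ {P P′ Q} → Hom P′ P → Cls P Q → Cls P′ Q
  g ▷ (W , h) = W , g ⨾ h

  ▷-cong : ∀ {P P′ Q} (g : Hom P′ P) {x y : Cls P Q} → x ≈ᶜ y → (g ▷ x) ≈ᶜ (g ▷ y)
  ▷-cong g = gmap (g ▷_) slide-precomp
    where
    slide-precomp : ∀ {x y} → Slide1 x y → Slide1 (g ▷ x) (g ▷ y)
    slide-precomp (slide {W' = W′} h r) =
      subst (λ z → Slide1 (W′ , z) (g ▷ (_ , h))) (assoc g h (r ⊗₁ id)) (slide (g ⨾ h) r)

  embedTail : ∀ {Y₀ M A B U} → Hom (M ⊗₀ A) (U ⊗₀ B) → Hom ((M ⊗₀ Y₀) ⊗₀ A) (U ⊗₀ (B ⊗₀ Y₀))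
  embedTail {Y₀} u = asc ⨾ (id ⊗₁ σ) ⨾ asc⁻¹ ⨾ (u ⊗₁ id {Y₀}) ⨾ asc

  embed-precomp : ∀ {X₀ X₀′ Y₀ M A B U} (g : Hom X₀′ X₀) (h : Hom X₀ (M ⊗₀ Y₀)) (u : Hom (M ⊗₀ A) (U ⊗₀ B)) →
                  embed (g ⨾ h) u ≡ (g ⊗₁ id) ⨾ embed h u
  embed-precomp {Y₀ = Y₀} g h u = trans (cong (_⨾ embedTail {Y₀} u) (⊗id-⨾ g h)) (assoc _ _ _)

  embedTail-slide : ∀ {Y₀ M N A B U} (r : Hom N M) (u : Hom (M ⊗₀ A) (U ⊗₀ B)) →
                    ((r ⊗₁ id) ⊗₁ id) ⨾ embedTail {Y₀} u ≡ embedTail ((r ⊗₁ id) ⨾ u)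
  embedTail-slide r u = begin
    ((r ⊗₁ id) ⊗₁ id) ⨾ asc ⨾ (id ⊗₁ σ) ⨾ asc⁻¹ ⨾ (u ⊗₁ id) ⨾ asc
      ≡⟨ extendʳ (asc-natˡ r) ⟩
    asc ⨾ (r ⊗₁ id) ⨾ (id ⊗₁ σ) ⨾ asc⁻¹ ⨾ (u ⊗₁ id) ⨾ asc
      ≡⟨ cong (asc ⨾_) (extendʳ (⊗-interchange r σ)) ⟩
    asc ⨾ (id ⊗₁ σ) ⨾ (r ⊗₁ id) ⨾ asc⁻¹ ⨾ (u ⊗₁ id) ⨾ asc
      ≡⟨ cong (λ z → asc ⨾ (id ⊗₁ σ) ⨾ z) (extendʳ (sym (asc⁻¹-natˡ r))) ⟩
    asc ⨾ (id ⊗₁ σ) ⨾ asc⁻¹ ⨾ ((r ⊗₁ id) ⊗₁ id) ⨾ (u ⊗₁ id) ⨾ asc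
      ≡⟨ cong (λ z → asc ⨾ (id ⊗₁ σ) ⨾ asc⁻¹ ⨾ z)
              (trans (sym (assoc _ _ _)) (cong (_⨾ asc) (sym (⊗id-⨾ (r ⊗₁ id) u)))) ⟩
    asc ⨾ (id ⊗₁ σ) ⨾ asc⁻¹ ⨾ (((r ⊗₁ id) ⨾ u) ⊗₁ id) ⨾ asc
      ∎

  embed-slide : ∀ {X₀ Y₀ M N A B U} (h : Hom X₀ (N ⊗₀ Y₀)) (r : Hom N M) (u : Hom (M ⊗₀ A) (U ⊗₀ B)) →
                embed (h ⨾ (r ⊗₁ id)) u ≡ embed h ((r ⊗₁ id) ⨾ u)
  embed-slide h r u = trans (embed-precomp h (r ⊗₁ id) u) (cong ((h ⊗₁ id) ⨾_) (embedTail-slide r u))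

  embedTail-postcomp : ∀ {Y₀ M A B U U′} (u : Hom (M ⊗₀ A) (U ⊗₀ B)) (r : Hom U U′) →
                       embedTail {Y₀} (u ⨾ (r ⊗₁ id)) ≡ embedTail u ⨾ (r ⊗₁ id)
  embedTail-postcomp u r = begin
    asc ⨾ (id ⊗₁ σ) ⨾ asc⁻¹ ⨾ ((u ⨾ (r ⊗₁ id)) ⊗₁ id) ⨾ asc
      ≡⟨ cong (λ z → asc ⨾ (id ⊗₁ σ) ⨾ asc⁻¹ ⨾ z) (begin
           ((u ⨾ (r ⊗₁ id)) ⊗₁ id) ⨾ asc        ≡⟨ cong (_⨾ asc) (⊗id-⨾ u (r ⊗₁ id)) ⟩
           ((u ⊗₁ id) ⨾ ((r ⊗₁ id) ⊗₁ id)) ⨾ asc ≡⟨ assoc _ _ _ ⟩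
           (u ⊗₁ id) ⨾ ((r ⊗₁ id) ⊗₁ id) ⨾ asc   ≡⟨ cong ((u ⊗₁ id) ⨾_) (asc-natˡ r) ⟩
           (u ⊗₁ id) ⨾ asc ⨾ (r ⊗₁ id)           ∎) ⟩
    asc ⨾ (id ⊗₁ σ) ⨾ asc⁻¹ ⨾ (u ⊗₁ id) ⨾ asc ⨾ (r ⊗₁ id)
      ≡⟨ cong (λ z → asc ⨾ (id ⊗₁ σ) ⨾ asc⁻¹ ⨾ z) (assoc _ _ _) ⟨
    asc ⨾ (id ⊗₁ σ) ⨾ asc⁻¹ ⨾ ((u ⊗₁ id) ⨾ asc) ⨾ (r ⊗₁ id)
      ≡⟨ trans (assoc _ _ _) (cong (asc ⨾_) (trans (assoc _ _ _) (cong ((id ⊗₁ σ) ⨾_) (assoc _ _ _)))) ⟨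
    (asc ⨾ (id ⊗₁ σ) ⨾ asc⁻¹ ⨾ (u ⊗₁ id) ⨾ asc) ⨾ (r ⊗₁ id)
      ∎

  embed-postcomp : ∀ {X₀ Y₀ M A B U U′} (h : Hom X₀ (M ⊗₀ Y₀)) (u : Hom (M ⊗₀ A) (U ⊗₀ B)) (r : Hom U U′) →
                   embed h (u ⨾ (r ⊗₁ id)) ≡ embed h u ⨾ (r ⊗₁ id)
  embed-postcomp h u r = trans (cong ((h ⊗₁ id) ⨾_) (embedTail-postcomp u r)) (sym (assoc _ _ _))

  inputs : ℕ → Obj∞ → Obj
  inputs zero    X = X zero
  inputs (suc n) X = X zero ⊗₀ inputs n (X ⁺)

  outputs : ℕ → Obj∞ → Obj
  outputs zero    Y = Y zero
  outputs (suc n) Y = outputs n (Y ⁺) ⊗₀ Y zero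

  prepend : ∀ {P X₀ Y₀ M A B} → Hom (P ⊗₀ X₀) (M ⊗₀ Y₀) → Cls (M ⊗₀ A) B → Cls (P ⊗₀ (X₀ ⊗₀ A)) (B ⊗₀ Y₀)
  prepend h (W , u) = W , asc⁻¹ ⨾ embed h u

  -- the outputs Yᵢ are moved aside by the symmetry, as in embed
  composite : ∀ n {P X Y} → Chain n P X Y → Cls (P ⊗₀ inputs n X) (outputs n Y)
  composite zero    c           = c
  composite (suc n) (M , h , c) = prepend h (composite n c)

  asc▷prepend : ∀ {P X₀ Y₀ M A B} (h : Hom (P ⊗₀ X₀) (M ⊗₀ Y₀)) (x : Cls (M ⊗₀ A) B) →
                asc ▷ prepend h x ≡ (proj₁ x , embed h (proj₂ x))
  asc▷prepend h (W , u) = cong (W ,_) (cancelˡ asc-isoˡ)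

  prepend-precomp : ∀ {P P′ X₀ Y₀ M A B} (r : Hom P′ P) (h : Hom (P ⊗₀ X₀) (M ⊗₀ Y₀)) (x : Cls (M ⊗₀ A) B) →
                    prepend ((r ⊗₁ id) ⨾ h) x ≡ (r ⊗₁ id) ▷ prepend h x
  prepend-precomp r h (W , u) = cong (W ,_) (begin
    asc⁻¹ ⨾ embed ((r ⊗₁ id) ⨾ h) u          ≡⟨ cong (asc⁻¹ ⨾_) (embed-precomp (r ⊗₁ id) h u) ⟩
    asc⁻¹ ⨾ ((r ⊗₁ id) ⊗₁ id) ⨾ embed h u    ≡⟨ extendʳ (asc⁻¹-natˡ r) ⟩
    (r ⊗₁ id) ⨾ asc⁻¹ ⨾ embed h u            ∎)

  prepend-slide : ∀ {P X₀ Y₀ M N A B} (h : Hom (P ⊗₀ X₀) (N ⊗₀ Y₀)) (r : Hom N M) (x : Cls (M ⊗₀ A) B) →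
                  prepend (h ⨾ (r ⊗₁ id)) x ≡ prepend h ((r ⊗₁ id) ▷ x)
  prepend-slide h r (W , u) = cong (λ z → W , asc⁻¹ ⨾ z) (embed-slide h r u)

  prepend-cong : ∀ {P X₀ Y₀ M A B} (h : Hom (P ⊗₀ X₀) (M ⊗₀ Y₀)) {x y : Cls (M ⊗₀ A) B} →
                 x ≈ᶜ y → prepend h x ≈ᶜ prepend h y
  prepend-cong h = gmap (prepend h) slide-prepend
    where
    slide-prepend : ∀ {x y} → Slide1 x y → Slide1 (prepend h x) (prepend h y)
    slide-prepend (slide {W' = W′} u r) =
      subst (λ z → Slide1 (W′ , z) (prepend h (_ , u)))
        (sym (trans (cong (asc⁻¹ ⨾_) (embed-postcomp h u r)) (sym (assoc _ _ _))))
        (slide (asc⁻¹ ⨾ embed h u) r)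

  composite-pre : ∀ n {P P′ X Y} (r : Hom P′ P) (c : Chain n P X Y) →
                  composite n (pre n r c) ≡ (r ⊗₁ id) ▷ composite n c
  composite-pre zero    r c           = refl
  composite-pre (suc n) r (M , h , c) = prepend-precomp r h (composite n c)

  composite-cong-step : ∀ {n P X Y} {c c′ : Chain n P X Y} →
                        StageStep n P X Y c c′ → composite n c ≈ᶜ composite n c′
  composite-cong-step (last h r)          = return (slide h r)
  composite-cong-step {suc n} (mid h r c) =
    ≡⇒≈ (trans (prepend-slide h r (composite n c)) (cong (prepend h) (sym (composite-pre n r c))))
  composite-cong-step (deeper h step)     = prepend-cong h (composite-cong-step step)

  StageEqFrom : ∀ n P X Y → Chain n P X Y → Chain n P X Y → Set
  StageEqFrom n P X Y = EqClosure (StageStep n P X Y)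

  composite-cong : ∀ {n P X Y} {c c′ : Chain n P X Y} →
                   StageEqFrom n P X Y c c′ → composite n c ≈ᶜ composite n c′
  composite-cong {n} = gfold (EqClosure.isEquivalence Slide1) (composite n) composite-cong-step

  -- Productivity: composites determine stages

  Components : Obj → (ℕ → Obj) → Obj∞ → Obj∞ → Set
  Components P M X Y = (n : ℕ) → Hom (prevP P M n ⊗₀ X n) (M n ⊗₀ Y n)

  trunc-pointwise : ∀ n {P X Y} (M : ℕ → Obj) {f g : Components P M X Y} →
                    (∀ k → f k ≡ g k) → trunc n (M , f) ≡ trunc n (M , g)
  trunc-pointwise zero    M f≡g = cong (M zero ,_) (f≡g zero)
  trunc-pointwise (suc n) M f≡g =
    cong₂ (λ a b → M zero , a , b) (f≡g zero)
      (trunc-pointwise n (λ k → M (suc k)) λ { zero → f≡g (suc zero) ; (suc k) → f≡g (suc (suc k)) })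

  precompComponents : ∀ {P N X Y} {M : ℕ → Obj} → Hom N P → Components P M X Y → Components N M X Y
  precompComponents r f zero    = (r ⊗₁ id) ⨾ f zero
  precompComponents r f (suc n) = f (suc n)

  precompSeq : ∀ {P N X Y} → Hom N P → DSeqFrom P X Y → DSeqFrom N X Y
  precompSeq r (M , f) = M , precompComponents r f

  trunc-precompSeq : ∀ n {P N X Y} (r : Hom N P) (s : DSeqFrom P X Y) →
                     trunc n (precompSeq r s) ≡ pre n r (trunc n s)
  trunc-precompSeq zero    r s       = refl
  trunc-precompSeq (suc n) r (M , f) =
    cong (λ c → M zero , (r ⊗₁ id) ⨾ f zero , c)
      (trunc-pointwise n (λ k → M (suc k)) λ { zero → refl ; (suc k) → refl })

  stage-deeper : ∀ {n P X Y M} (h : Hom (P ⊗₀ X zero) (M ⊗₀ Y zero)) {c c′ : Chain n M (X ⁺) (Y ⁺)} →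
                 StageEqFrom n M (X ⁺) (Y ⁺) c c′ → StageEqFrom (suc n) P X Y (M , h , c) (M , h , c′)
  stage-deeper h = gmap (λ c → _ , h , c) (deeper h)

  stage-factor-head : ∀ {n P X Y M M₀} {h : Hom (P ⊗₀ X zero) (M ⊗₀ Y zero)}
                        (α : Hom (P ⊗₀ X zero) (M₀ ⊗₀ Y zero)) (s : Hom M₀ M) (c : Chain n M (X ⁺) (Y ⁺)) →
                      h ≡ α ⨾ (s ⊗₁ id) →
                      StageEqFrom (suc n) P X Y (M , h , c) (M₀ , α , pre n s c)
  stage-factor-head α s c refl = return (mid α s c)

  SameComposites : ∀ {P X Y} → DSeqFrom P X Y → DSeqFrom P X Y → Set
  SameComposites a b = ∀ n → composite n (trunc n a) ≈ᶜ composite n (trunc n b)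

  stageEq⇒sameComposites : ∀ {P X Y} {a b : DSeqFrom P X Y} →
                           (∀ n → StageEqFrom n P X Y (trunc n a) (trunc n b)) → SameComposites a b
  stageEq⇒sameComposites a≈b n = composite-cong (a≈b n)

  composite-precompSeq : ∀ n {P N X Y} (r : Hom N P) (s : DSeqFrom P X Y) →
                         composite n (trunc n (precompSeq r s)) ≡ (r ⊗₁ id) ▷ composite n (trunc n s)
  composite-precompSeq n r s =
    trans (cong (composite n) (trunc-precompSeq n r s)) (composite-pre n r (trunc n s))

  record CommonHead {P X Y} (a b : DSeqFrom P X Y) : Set where
    field
      M₀ : Obj
      α₀ : Hom (P ⊗₀ X zero) (M₀ ⊗₀ Y zero)
      sᵃ : Hom M₀ (proj₁ a zero)
      sᵇ : Hom M₀ (proj₁ b zero)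
      factorᵃ : proj₂ a zero ≡ α₀ ⨾ (sᵃ ⊗₁ id)
      factorᵇ : proj₂ b zero ≡ α₀ ⨾ (sᵇ ⊗₁ id)
      sameTails : SameComposites (precompSeq sᵃ (tailSeq a)) (precompSeq sᵇ (tailSeq b))

  commonHead : Productive → ∀ {P X Y} (a b : DSeqFrom P X Y) → SameComposites a b → CommonHead a b
  commonHead prod {P} {X} {Y} a@(Ma , fa) b@(Mb , fb) same = record
    { M₀ = M0 ; α₀ = α0 ; sᵃ = sᵃ ; sᵇ = sᵇ
    ; factorᵃ = factor (fa zero) ε ; factorᵇ = factor (fb zero) b₀≈a₀
    ; sameTails = sameTails
    }
    where
    open Terminating (prod (P ⊗₀ X zero) (Y zero) (Ma zero) (fa zero))
    b₀≈a₀ : (Mb zero , fb zero) ≈ᶜ (Ma zero , fa zero)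
    b₀≈a₀ = EqClosure.symmetric _ (same zero)
    sᵃ = s (fa zero) ε
    sᵇ = s (fb zero) b₀≈a₀
    sameTails : SameComposites (precompSeq sᵃ (tailSeq a)) (precompSeq sᵇ (tailSeq b))
    sameTails k =
      subst₂ _≈ᶜ_ (sym (composite-precompSeq k sᵃ (tailSeq a))) (sym (composite-precompSeq k sᵇ (tailSeq b)))
      (reflect (fa zero) ε (fb zero) b₀≈a₀ _ _
        (subst₂ _≈ᶜ_ (asc▷prepend (fa zero) _) (asc▷prepend (fb zero) _) (▷-cong asc (same (suc k)))))

  sameComposites⇒stageEq : Productive → ∀ n {P X Y} (a b : DSeqFrom P X Y) →
                           SameComposites a b → StageEqFrom n P X Y (trunc n a) (trunc n b)
  sameComposites⇒stageEq prod zero    a b same = EqClosure.map (λ { (slide h r) → last h r }) (same zero)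
  sameComposites⇒stageEq prod (suc n) a b same =
    stage-factor-head α₀ sᵃ _ factorᵃ
      ◅◅ stage-deeper α₀ (subst₂ (StageEqFrom n M₀ _ _)
                            (trunc-precompSeq n sᵃ (tailSeq a)) (trunc-precompSeq n sᵇ (tailSeq b))
                            (sameComposites⇒stageEq prod n _ _ sameTails))
      ◅◅ EqClosure.symmetric _ (stage-factor-head α₀ sᵇ _ factorᵇ)
    where open CommonHead (commonHead prod a b same)

  actHom : ∀ {P M X₀ X₀′ Y₀ Y₀′} → Hom X₀′ X₀ → Hom Y₀ Y₀′ →
           Hom (P ⊗₀ X₀) (M ⊗₀ Y₀) → Hom (P ⊗₀ X₀′) (M ⊗₀ Y₀′)
  actHom f g h = (id ⊗₁ f) ⨾ h ⨾ (id ⊗₁ g)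

  actHom-postcomp : ∀ {P M N X₀ X₀′ Y₀ Y₀′} (f : Hom X₀′ X₀) (g : Hom Y₀ Y₀′)
                      (h : Hom (P ⊗₀ X₀) (N ⊗₀ Y₀)) (r : Hom N M) →
                    actHom f g (h ⨾ (r ⊗₁ id)) ≡ actHom f g h ⨾ (r ⊗₁ id)
  actHom-postcomp f g h r =
    trans (cong ((id ⊗₁ f) ⨾_)
                (trans (assoc _ _ _) (trans (cong (h ⨾_) (⊗-interchange r g)) (sym (assoc _ _ _)))))
          (sym (assoc _ _ _))

  actHom-precomp : ∀ {P P′ M X₀ X₀′ Y₀ Y₀′} (f : Hom X₀′ X₀) (g : Hom Y₀ Y₀′)
                     (h : Hom (P ⊗₀ X₀) (M ⊗₀ Y₀)) (r : Hom P′ P) →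
                   actHom f g ((r ⊗₁ id) ⨾ h) ≡ (r ⊗₁ id) ⨾ actHom f g h
  actHom-precomp f g h r = trans (cong ((id ⊗₁ f) ⨾_) (assoc _ _ _)) (extendʳ (sym (⊗-interchange r f)))

  actHom-⨾ : ∀ {P M X₀ X₁ X₂ Y₀ Y₁ Y₂} (f′ : Hom X₂ X₁) (f : Hom X₁ X₀) (h : Hom (P ⊗₀ X₀) (M ⊗₀ Y₀))
               (g : Hom Y₀ Y₁) (g′ : Hom Y₁ Y₂) →
             actHom (f′ ⨾ f) (g ⨾ g′) h ≡ actHom f′ g′ (actHom f g h)
  actHom-⨾ f′ f h g g′ = begin
    (id ⊗₁ (f′ ⨾ f)) ⨾ h ⨾ (id ⊗₁ (g ⨾ g′))
      ≡⟨ cong₂ (λ a b → a ⨾ h ⨾ b) (id⊗-⨾ f′ f) (id⊗-⨾ g g′) ⟩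
    ((id ⊗₁ f′) ⨾ (id ⊗₁ f)) ⨾ h ⨾ (id ⊗₁ g) ⨾ (id ⊗₁ g′)
      ≡⟨ assoc _ _ _ ⟩
    (id ⊗₁ f′) ⨾ (id ⊗₁ f) ⨾ h ⨾ (id ⊗₁ g) ⨾ (id ⊗₁ g′)
      ≡⟨ cong (λ z → (id ⊗₁ f′) ⨾ (id ⊗₁ f) ⨾ z) (assoc _ _ _) ⟨
    (id ⊗₁ f′) ⨾ (id ⊗₁ f) ⨾ (h ⨾ (id ⊗₁ g)) ⨾ (id ⊗₁ g′)
      ≡⟨ cong ((id ⊗₁ f′) ⨾_) (assoc _ _ _) ⟨
    (id ⊗₁ f′) ⨾ ((id ⊗₁ f) ⨾ h ⨾ (id ⊗₁ g)) ⨾ (id ⊗₁ g′)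
      ∎

  actChain : ∀ n {P X X′ Y Y′} → Hom∞ X′ X → Hom∞ Y Y′ → Chain n P X Y → Chain n P X′ Y′
  actChain zero    f g (M , h)     = M , actHom (f $ zero) (g $ zero) h
  actChain (suc n) f g (M , h , c) = M , actHom (f $ zero) (g $ zero) h , actChain n (f ⁺₁) (g ⁺₁) c

  actChain-pre : ∀ n {P P′ X X′ Y Y′} (f : Hom∞ X′ X) (g : Hom∞ Y Y′) (r : Hom P′ P) (c : Chain n P X Y) →
                 actChain n f g (pre n r c) ≡ pre n r (actChain n f g c)
  actChain-pre zero    f g r (M , h)     = cong (M ,_) (actHom-precomp _ _ h r)
  actChain-pre (suc n) f g r (M , h , c) =
    cong (λ z → M , z , actChain n (f ⁺₁) (g ⁺₁) c) (actHom-precomp _ _ h r)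

  actChain-step : ∀ {n P X X′ Y Y′} (f : Hom∞ X′ X) (g : Hom∞ Y Y′) {c c′ : Chain n P X Y} →
                  StageStep n P X Y c c′ → StageStep n P X′ Y′ (actChain n f g c) (actChain n f g c′)
  actChain-step {P = P} {X′ = X′} {Y′ = Y′} f g (last {M = M} {N} h r) =
    subst (λ z → StageStep zero P X′ Y′ (M , z) (N , actHom (f $ zero) (g $ zero) h))
      (sym (actHom-postcomp _ _ h r)) (last _ r)
  actChain-step {P = P} {X′ = X′} {Y′ = Y′} f g (mid {n} {M = M} {N} h r c) =
    subst₂ (λ z w → StageStep (suc n) P X′ Y′ (M , z , actChain n (f ⁺₁) (g ⁺₁) c)
                                               (N , actHom (f $ zero) (g $ zero) h , w))
      (sym (actHom-postcomp _ _ h r)) (sym (actChain-pre n (f ⁺₁) (g ⁺₁) r c)) (mid _ r _)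
  actChain-step f g (deeper h step) = deeper _ (actChain-step (f ⁺₁) (g ⁺₁) step)

  actChain-pointwise : ∀ n {P X X′ Y Y′} {f f′ : Hom∞ X′ X} {g g′ : Hom∞ Y Y′} →
                       (∀ k → f $ k ≡ f′ $ k) → (∀ k → g $ k ≡ g′ $ k) → (c : Chain n P X Y) →
                       actChain n f g c ≡ actChain n f′ g′ c
  actChain-pointwise zero    f≡f′ g≡g′ (M , h)     =
    cong (M ,_) (cong₂ (λ a b → actHom a b h) (f≡f′ zero) (g≡g′ zero))
  actChain-pointwise (suc n) f≡f′ g≡g′ (M , h , c) =
    cong₂ (λ z w → M , z , w) (cong₂ (λ a b → actHom a b h) (f≡f′ zero) (g≡g′ zero))
      (actChain-pointwise n (λ k → f≡f′ (suc k)) (λ k → g≡g′ (suc k)) c)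

  trunc-oSeqAct : ∀ n {X X′ Y Y′} (f : Hom∞ X′ X) (g : Hom∞ Y Y′) (s : oSeqF X Y) →
                  trunc n (oSeqAct f g s) ≡ actChain n f g (trunc n s)
  trunc-oSeqAct n f g s = go n f g (proj₁ s) (proj₂ s)
    where
    go : ∀ n {P X X′ Y Y′} (f : Hom∞ X′ X) (g : Hom∞ Y Y′) (M : ℕ → Obj) (h : Components P M X Y) →
         trunc n (M , λ k → actHom (f $ k) (g $ k) (h k)) ≡ actChain n f g (trunc n (M , h))
    go zero    f g M h = refl
    go (suc n) f g M h =
      cong (λ c → M zero , actHom (f $ zero) (g $ zero) (h zero) , c)
        (trans (trunc-pointwise n (λ k → M (suc k)) λ { zero → refl ; (suc k) → refl })
               (go n (f ⁺₁) (g ⁺₁) (λ k → M (suc k)) _))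

  ≈ₒ-isEquivalence : ∀ {X Y} → IsEquivalence (_≈ₒ_ {X} {Y})
  ≈ₒ-isEquivalence = record
    { refl  = λ n → ε
    ; sym   = λ a≈b n → EqClosure.symmetric _ (a≈b n)
    ; trans = λ a≈b b≈c n → a≈b n ◅◅ b≈c n
    }

  oSeq-isProfunctor : IsProfunctor oSeq
  oSeq-isProfunctor = record
    { isEquiv  = ≈ₒ-isEquivalence
    ; act-cong = act-cong
    ; act-id   = λ { (M , h) n → ≡⇒≈ (trunc-pointwise n M (λ k → id⊗id-conjugate (h k))) }
    ; act-comp = λ { f f′ g g′ (M , h) n →
                     ≡⇒≈ (trunc-pointwise n M (λ k → actHom-⨾ (f′ $ k) (f $ k) (h k) (g $ k) (g′ $ k))) }
    }
    where
    act-cong : ∀ {X X′ Y Y′} {f f′ : Hom∞ X′ X} {g g′ : Hom∞ Y Y′} {x y : oSeqF X Y} →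
               (∀ n → f $ n ≡ f′ $ n) → (∀ n → g $ n ≡ g′ $ n) → x ≈ₒ y → oSeqAct f g x ≈ₒ oSeqAct f′ g′ y
    act-cong {X′ = X′} {Y′ = Y′} {f} {f′} {g} {g′} {x} {y} f≡f′ g≡g′ x≈y n =
      subst₂ (StageEq n X′ Y′)
        (sym (trunc-oSeqAct n f g x))
        (sym (trans (trunc-oSeqAct n f′ g′ y) (sym (actChain-pointwise n f≡f′ g≡g′ _))))
        (gmap (actChain n f g) (actChain-step f g) (x≈y n))

  ≡-trunc⇒≈ₒ : ∀ {X Y} {a b : oSeqF X Y} → (∀ n → trunc n a ≡ trunc n b) → a ≈ₒ b
  ≡-trunc⇒≈ₒ a≡b n = ≡⇒≈ (a≡b n)

  luPre : ∀ n {M X Y} → Chain n M X Y → Chain n I (M · X) Y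
  luPre zero    (N , h)     = N , lu ⨾ h
  luPre (suc n) (N , h , c) = N , lu ⨾ h , c

  luPre-step : ∀ {n M X Y} {c c′ : Chain n M X Y} → StageStep n M X Y c c′ →
               StageStep n I (M · X) Y (luPre n c) (luPre n c′)
  luPre-step {M = M} {X} {Y} (last {M = M′} {N} h r) =
    subst (λ z → StageStep zero I (M · X) Y (M′ , z) (N , lu ⨾ h)) (assoc lu h (r ⊗₁ id)) (last (lu ⨾ h) r)
  luPre-step {M = M} {X} {Y} (mid {n} {M = M′} {N} h r c) =
    subst (λ z → StageStep (suc n) I (M · X) Y (M′ , z , c) (N , lu ⨾ h , pre n r c)) (assoc lu h (r ⊗₁ id))
      (mid (lu ⨾ h) r c)
  luPre-step (deeper h step) = deeper (lu ⨾ h) step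

  luPre-cong : ∀ {n M X Y} {c c′ : Chain n M X Y} →
               StageEqFrom n M X Y c c′ → StageEq n (M · X) Y (luPre n c) (luPre n c′)
  luPre-cong {n} = gmap (luPre n) luPre-step

  luComponents : ∀ {M X Y} {Ms : ℕ → Obj} → Components M Ms X Y → Components I Ms (M · X) Y
  luComponents f zero    = lu ⨾ f zero
  luComponents f (suc n) = f (suc n)

  trunc-luComponents : ∀ n {M X Y} (Ms : ℕ → Obj) (f : Components M Ms X Y) →
                       trunc n (Ms , luComponents f) ≡ luPre n (trunc n (Ms , f))
  trunc-luComponents zero    Ms f = refl
  trunc-luComponents (suc n) Ms f =
    cong (λ c → Ms zero , lu ⨾ f zero , c)
      (trunc-pointwise n (λ k → Ms (suc k)) λ { zero → refl ; (suc k) → refl })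

  trunc-ξtail-slide : ∀ n {X Y M₀} (s : oSeqF X Y) (r : Hom M₀ (proj₁ s zero)) →
                      trunc n (oSeqAct (r ·₁ id∞) id∞ (ΦObj.q (oSeqξ s)))
                        ≡ luPre n (trunc n (precompSeq r (tailSeq s)))
  trunc-ξtail-slide n (M , f) r =
    trans (trunc-pointwise n (λ k → M (suc k))
             λ { zero → lu-slide (r ⊗₁ id) (f (suc zero)) ; (suc k) → id⊗id-conjugate _ })
          (trunc-luComponents n _ _)

  oSeqξ-factor : ∀ {X Y M₀} (s : oSeqF X Y) {α : Hom (I ⊗₀ X zero) (M₀ ⊗₀ Y zero)}
                   {r : Hom M₀ (proj₁ s zero)} →
                 proj₂ s zero ≡ α ⨾ (r ⊗₁ id) →
                 oSeqξ s ≡ ⟨ proj₁ s zero , (lu⁻¹ ⨾ α) ⨾ (r ⊗₁ id) , ΦObj.q (oSeqξ s) ⟩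
  oSeqξ-factor s e =
    cong (λ z → ⟨ proj₁ s zero , z , ΦObj.q (oSeqξ s) ⟩) (trans (cong (lu⁻¹ ⨾_) e) (sym (assoc _ _ _)))

  oSeqξ-cong : Productive → ∀ {X Y} {a b : oSeqF X Y} → a ≈ₒ b → _≈Φ_ oSeq (oSeqξ a) (oSeqξ b)
  oSeqξ-cong prod {X} {Y} {a} {b} a≈b =
    ≡⇒≈ (oSeqξ-factor a factorᵃ)
      ◅◅ return (slide (lu⁻¹ ⨾ α₀) sᵃ _)
      ◅◅ return (cong-q (lu⁻¹ ⨾ α₀) tails≈)
      ◅◅ EqClosure.symmetric _ (return (slide (lu⁻¹ ⨾ α₀) sᵇ _))
      ◅◅ ≡⇒≈ (sym (oSeqξ-factor b factorᵇ))
    where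
    open CommonHead (commonHead prod a b (stageEq⇒sameComposites a≈b))
    tails≈ : oSeqAct (sᵃ ·₁ id∞) id∞ (ΦObj.q (oSeqξ a)) ≈ₒ oSeqAct (sᵇ ·₁ id∞) id∞ (ΦObj.q (oSeqξ b))
    tails≈ n = subst₂ (StageEq n (M₀ · (X ⁺)) (Y ⁺))
                 (sym (trunc-ξtail-slide n a sᵃ)) (sym (trunc-ξtail-slide n b sᵇ))
                 (luPre-cong (sameComposites⇒stageEq prod n _ _ sameTails))

  oSeqξ-nat : ∀ {X X′ Y Y′} (f : Hom∞ X′ X) (g : Hom∞ Y Y′) (s : oSeqF X Y) →
              _≈Φ_ oSeq (oSeqξ (oSeqAct f g s)) (Φact oSeq f g (oSeqξ s))
  oSeqξ-nat f g (M , h) =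
    ≡⇒≈ (cong (λ z → ⟨ M zero , z , ΦObj.q (oSeqξ (oSeqAct f g (M , h))) ⟩) (lu⁻¹-pull (f $ zero) (h zero) _))
      ◅◅ return (cong-q _ (≡-trunc⇒≈ₒ λ n → trunc-pointwise n (λ k → M (suc k)) λ
           { zero    → sym (lu-pull (id ⊗₁ (f $ suc zero)) (h (suc zero)) _)
           ; (suc k) → refl
           }))

  oSeq-isCoalg : Productive → IsCoalg oSeq oSeqξ
  oSeq-isCoalg prod = record { ξ-cong = oSeqξ-cong prod ; ξ-nat = oSeqξ-nat }

  unlu : ∀ n {M X Y} → Chain n I (M · X) Y → Chain n M X Y
  unlu zero    (N , h)     = N , lu⁻¹ ⨾ h
  unlu (suc n) (N , h , c) = N , lu⁻¹ ⨾ h , c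

  unlu-step : ∀ {n M X Y} {c c′ : Chain n I (M · X) Y} → StageStep n I (M · X) Y c c′ →
              StageStep n M X Y (unlu n c) (unlu n c′)
  unlu-step {M = M} {X} {Y} (last {M = M′} {N} h r) =
    subst (λ z → StageStep zero M X Y (M′ , z) (N , lu⁻¹ ⨾ h)) (assoc lu⁻¹ h (r ⊗₁ id)) (last (lu⁻¹ ⨾ h) r)
  unlu-step {M = M} {X} {Y} (mid {n} {M = M′} {N} h r c) =
    subst (λ z → StageStep (suc n) M X Y (M′ , z , c) (N , lu⁻¹ ⨾ h , pre n r c)) (assoc lu⁻¹ h (r ⊗₁ id))
      (mid (lu⁻¹ ⨾ h) r c)
  unlu-step (deeper h step) = deeper (lu⁻¹ ⨾ h) step

  unlu-cong : ∀ {n M X Y} {c c′ : Chain n I (M · X) Y} →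
              StageEq n (M · X) Y c c′ → StageEqFrom n M X Y (unlu n c) (unlu n c′)
  unlu-cong {n} = gmap (unlu n) unlu-step

  unluComponents : ∀ {M X Y} {Ms : ℕ → Obj} → Components I Ms (M · X) Y → Components M Ms X Y
  unluComponents f zero    = lu⁻¹ ⨾ f zero
  unluComponents f (suc n) = f (suc n)

  unluSeq : ∀ {M X Y} → oSeqF (M · X) Y → DSeqFrom M X Y
  unluSeq (Ms , f) = Ms , unluComponents f

  unlu-trunc : ∀ n {M X Y} (t : oSeqF (M · X) Y) → unlu n (trunc n t) ≡ trunc n (unluSeq t)
  unlu-trunc zero    t        = refl
  unlu-trunc (suc n) (Ms , f) =
    cong (λ c → Ms zero , lu⁻¹ ⨾ f zero , c)
      (trunc-pointwise n (λ k → Ms (suc k)) λ { zero → refl ; (suc k) → refl })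

  unlu-trunc-slide : ∀ n {M N X Y} (r : Hom M N) (t : oSeqF (N · X) Y) →
                     unlu n (trunc n (oSeqAct (r ·₁ id∞) id∞ t)) ≡ pre n r (unlu n (trunc n t))
  unlu-trunc-slide n r t@(Ms , f) = begin
    unlu n (trunc n (oSeqAct (r ·₁ id∞) id∞ t))  ≡⟨ unlu-trunc n _ ⟩
    trunc n (unluSeq (oSeqAct (r ·₁ id∞) id∞ t))
      ≡⟨ trunc-pointwise n Ms (λ { zero → lu⁻¹-slide (r ⊗₁ id) (f zero) ; (suc k) → id⊗id-conjugate _ }) ⟩
    trunc n (precompSeq r (unluSeq t))           ≡⟨ trunc-precompSeq n r _ ⟩
    pre n r (trunc n (unluSeq t))                ≡⟨ cong (pre n r) (unlu-trunc n t) ⟨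
    pre n r (unlu n (trunc n t))                 ∎

  -- ⟨ M , h , t ⟩ stands for the sequence (h, t₀, t₁, …); the unitors only adjust the junction.
  stageΦ : ∀ n {X Y} → ΦObj oSeq X Y → Chain n I X Y
  stageΦ zero    ⟨ M , h , t ⟩ = M , lu ⨾ h
  stageΦ (suc n) ⟨ M , h , t ⟩ = M , lu ⨾ h , unlu n (trunc n t)

  trunc≡stageΦ-ξ : ∀ n {X Y} (s : oSeqF X Y) → trunc n s ≡ stageΦ n (oSeqξ s)
  trunc≡stageΦ-ξ zero    (M , f) = cong (M zero ,_) (sym (cancelˡ lu-isoˡ))
  trunc≡stageΦ-ξ (suc n) (M , f) =
    cong₂ (λ a c → M zero , a , c) (sym (cancelˡ lu-isoˡ))
      (trans (trunc-pointwise n (λ k → M (suc k)) λ { zero → sym (cancelˡ lu-isoʳ) ; (suc k) → refl })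
             (sym (unlu-trunc n _)))

  stageΦ-slide : ∀ n {X Y M N} (h : Hom (X zero) (M ⊗₀ Y zero)) (r : Hom M N) (t : oSeqF (N · (X ⁺)) (Y ⁺)) →
                 StageEq n X Y (stageΦ n ⟨ N , h ⨾ (r ⊗₁ id) , t ⟩)
                               (stageΦ n ⟨ M , h , oSeqAct (r ·₁ id∞) id∞ t ⟩)
  stageΦ-slide zero {X} {Y} {M} {N} h r t =
    return (subst (λ z → StageStep zero I X Y (N , z) (M , lu ⨾ h)) (assoc lu h (r ⊗₁ id)) (last (lu ⨾ h) r))
  stageΦ-slide (suc n) {X} {Y} {M} {N} h r t =
    return (subst₂ (λ z c → StageStep (suc n) I X Y (N , z , unlu n (trunc n t)) (M , lu ⨾ h , c))
              (assoc lu h (r ⊗₁ id)) (sym (unlu-trunc-slide n r t)) (mid (lu ⨾ h) r _))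

  stageΦ-tail-cong : ∀ n {X Y M} (h : Hom (X zero) (M ⊗₀ Y zero)) {t t′ : oSeqF (M · (X ⁺)) (Y ⁺)} →
                     StageEq n (M · (X ⁺)) (Y ⁺) (trunc n t) (trunc n t′) →
                     StageEq (suc n) X Y (stageΦ (suc n) {X} {Y} ⟨ M , h , t ⟩)
                                         (stageΦ (suc n) {X} {Y} ⟨ M , h , t′ ⟩)
  stageΦ-tail-cong n h t≈t′ = stage-deeper (lu ⨾ h) (unlu-cong t≈t′)

  stageΦ-cong-step : ∀ n {X Y} {p p′ : ΦObj oSeq X Y} →
                     ΦGen oSeq p p′ → StageEq n X Y (stageΦ n p) (stageΦ n p′)
  stageΦ-cong-step n       (slide h r t)   = stageΦ-slide n h r t
  stageΦ-cong-step zero    (cong-q h t≈t′) = ε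
  stageΦ-cong-step (suc n) (cong-q h t≈t′) = stageΦ-tail-cong n h (t≈t′ n)

  stageΦ-cong : ∀ n {X Y} {p p′ : ΦObj oSeq X Y} → _≈Φ_ oSeq p p′ → StageEq n X Y (stageΦ n p) (stageΦ n p′)
  stageΦ-cong n = gfold (EqClosure.isEquivalence _) (stageΦ n) (stageΦ-cong-step n)

  module Unfold (A : RawProf) (ξA : CoalgStr A) (A-isCoalg : IsCoalg A ξA) where
    open RawProf A renaming (F to FA; _≈_ to _≈A_; act to actA)
    open IsCoalg A-isCoalg

    unfoldObj : ∀ {X Y} → FA X Y → ℕ → Obj
    unfoldObj x zero            = ΦObj.M (ξA x)
    unfoldObj {X} {Y} x (suc n) = unfoldObj {ΦObj.M (ξA x) · (X ⁺)} {Y ⁺} (ΦObj.q (ξA x)) n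

    -- Without the unitor on its first component, so that the later components have the required
    -- types by definition; unfold adds the unitor once.
    unfoldFrom : ∀ N X Y (y : FA (N · X) Y) → Components N (unfoldObj y) X Y
    unfoldFrom N X Y y zero          = ΦObj.h (ξA y)
    unfoldFrom N X Y y (suc zero)    = unfoldFrom (ΦObj.M (ξA y)) ((N · X) ⁺) (Y ⁺) (ΦObj.q (ξA y)) zero
    unfoldFrom N X Y y (suc (suc n)) = unfoldFrom (ΦObj.M (ξA y)) ((N · X) ⁺) (Y ⁺) (ΦObj.q (ξA y)) (suc n)

    unfold : ∀ {X Y} → FA X Y → oSeqF X Y
    unfold {X} {Y} x = unfoldObj x , components
      where
      components : Components I (unfoldObj x) X Y
      components zero          = lu ⨾ ΦObj.h (ξA x)
      components (suc zero)    = unfoldFrom (ΦObj.M (ξA x)) (X ⁺) (Y ⁺) (ΦObj.q (ξA x)) zero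
      components (suc (suc n)) = unfoldFrom (ΦObj.M (ξA x)) (X ⁺) (Y ⁺) (ΦObj.q (ξA x)) (suc n)

    trunc-unfold : ∀ n {X Y} (x : FA X Y) → trunc n (unfold x) ≡ stageΦ n (Φmap A oSeq unfold (ξA x))
    trunc-unfold zero    x = refl
    trunc-unfold (suc n) x =
      cong (λ c → ΦObj.M (ξA x) , lu ⨾ ΦObj.h (ξA x) , c)
        (trans (trunc-pointwise n _ λ
                  { zero          → sym (cancelˡ lu-isoʳ)
                  ; (suc zero)    → refl
                  ; (suc (suc k)) → refl
                  })
               (sym (unlu-trunc n _)))

    unfold-isCoalgHom : IsCoalgHom A oSeq ξA oSeqξ unfold
    unfold-isCoalgHom x =
      ≡⇒≈ (cong (λ z → ⟨ ΦObj.M (ξA x) , z , ΦObj.q (oSeqξ (unfold x)) ⟩) (cancelˡ lu-isoʳ))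
        ◅◅ return (cong-q _ (≡-trunc⇒≈ₒ λ n →
             trunc-pointwise n _ λ { zero → refl ; (suc zero) → refl ; (suc (suc k)) → refl }))

    coalgHom-stage : (w : ∀ {X Y} → FA X Y → oSeqF X Y) → IsCoalgHom A oSeq ξA oSeqξ w →
                     ∀ n {X Y} (x : FA X Y) → StageEq n X Y (trunc n (w x)) (stageΦ n (Φmap A oSeq w (ξA x)))
    coalgHom-stage w w-hom n x = ≡⇒≈ (trunc≡stageΦ-ξ n (w x)) ◅◅ stageΦ-cong n (w-hom x)

    coalgHom-unique : (w w′ : ∀ {X Y} → FA X Y → oSeqF X Y) →
                      IsCoalgHom A oSeq ξA oSeqξ w → IsCoalgHom A oSeq ξA oSeqξ w′ →
                      ∀ n {X Y} (x : FA X Y) → StageEq n X Y (trunc n (w x)) (trunc n (w′ x))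
    coalgHom-unique w w′ w-hom w′-hom zero x =
      coalgHom-stage w w-hom zero x ◅◅ EqClosure.symmetric _ (coalgHom-stage w′ w′-hom zero x)
    coalgHom-unique w w′ w-hom w′-hom (suc n) x =
      coalgHom-stage w w-hom (suc n) x
        ◅◅ stageΦ-tail-cong n (ΦObj.h (ξA x)) (coalgHom-unique w w′ w-hom w′-hom n (ΦObj.q (ξA x)))
        ◅◅ EqClosure.symmetric _ (coalgHom-stage w′ w′-hom (suc n) x)

    UnfoldCongAt : ℕ → Set
    UnfoldCongAt n = ∀ {X Y} {x y : FA X Y} → x ≈A y → StageEq n X Y (trunc n (unfold x)) (trunc n (unfold y))

    UnfoldNatAt : ℕ → Set
    UnfoldNatAt n = ∀ {X X′ Y Y′} (f : Hom∞ X′ X) (g : Hom∞ Y Y′) (x : FA X Y) →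
                    StageEq n X′ Y′ (trunc n (unfold (actA f g x))) (trunc n (oSeqAct f g (unfold x)))

    -- Congruence and naturality of unfold at stage n+1 each need both at stage n.
    InvariantsBelow : ℕ → Set
    InvariantsBelow zero    = ⊤
    InvariantsBelow (suc m) = UnfoldCongAt m × UnfoldNatAt m

    stageΦ-Φmap-cong-step : ∀ n → InvariantsBelow n → ∀ {X Y} {p p′ : ΦObj A X Y} → ΦGen A p p′ →
                            StageEq n X Y (stageΦ n (Φmap A oSeq unfold p)) (stageΦ n (Φmap A oSeq unfold p′))
    stageΦ-Φmap-cong-step zero    _          (slide h r q) = stageΦ-slide zero h r (unfold q)
    stageΦ-Φmap-cong-step zero    _          (cong-q h e)  = ε
    stageΦ-Φmap-cong-step (suc m) (_ , nat)  (slide h r q) =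
      stageΦ-slide (suc m) h r (unfold q)
        ◅◅ stageΦ-tail-cong m h (EqClosure.symmetric _ (nat (r ·₁ id∞) id∞ q))
    stageΦ-Φmap-cong-step (suc m) (cong , _) (cong-q h e)  = stageΦ-tail-cong m h (cong e)

    stageΦ-Φmap-cong : ∀ n → InvariantsBelow n → ∀ {X Y} {p p′ : ΦObj A X Y} → _≈Φ_ A p p′ →
                       StageEq n X Y (stageΦ n (Φmap A oSeq unfold p)) (stageΦ n (Φmap A oSeq unfold p′))
    stageΦ-Φmap-cong n below = gfold (EqClosure.isEquivalence _) (λ p → stageΦ n (Φmap A oSeq unfold p))
                                 (stageΦ-Φmap-cong-step n below)

    stageΦ-Φact : ∀ n → InvariantsBelow n → ∀ {X X′ Y Y′} (f : Hom∞ X′ X) (g : Hom∞ Y Y′) (x : FA X Y) →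
                  StageEq n X′ Y′ (stageΦ n (Φmap A oSeq unfold (Φact A f g (ξA x))))
                                  (trunc n (oSeqAct f g (unfold x)))
    stageΦ-Φact zero    _         f g x = ≡⇒≈ (cong (_ ,_) (sym (lu-pull (f $ zero) (ΦObj.h (ξA x)) _)))
    stageΦ-Φact (suc m) (_ , nat) f g x =
      stageΦ-tail-cong m _ (nat (id ·₁ (f ⁺₁)) (g ⁺₁) (ΦObj.q (ξA x)))
        ◅◅ ≡⇒≈ (cong₂ (λ a c → _ , a , c) (sym (lu-pull (f $ zero) (ΦObj.h (ξA x)) _))
                 (trans (unlu-trunc m _) (trunc-pointwise m _ λ
                   { zero          → trans (cong (lu⁻¹ ⨾_) (lu-pull (id ⊗₁ (f $ suc zero)) _ _))
                                               (cancelˡ lu-isoʳ)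
                   ; (suc zero)    → refl
                   ; (suc (suc k)) → refl
                   })))

    unfold-invariants : ∀ n → UnfoldCongAt n × UnfoldNatAt n
    invariants-below : ∀ n → InvariantsBelow n

    unfold-invariants n = cong-at , nat-at
      where
      cong-at : UnfoldCongAt n
      cong-at {x = x} {y} x≈y =
        ≡⇒≈ (trunc-unfold n x)
          ◅◅ stageΦ-Φmap-cong n (invariants-below n) (ξ-cong x≈y)
          ◅◅ ≡⇒≈ (sym (trunc-unfold n y))
      nat-at : UnfoldNatAt n
      nat-at f g x =
        ≡⇒≈ (trunc-unfold n (actA f g x))
          ◅◅ stageΦ-Φmap-cong n (invariants-below n) (ξ-nat f g x)
          ◅◅ stageΦ-Φact n (invariants-below n) f g x

    invariants-below zero    = tt
    invariants-below (suc m) = unfold-invariants m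

    unfold-isNat : IsNat A oSeq unfold
    unfold-isNat = record
      { u-cong = λ x≈y n → proj₁ (unfold-invariants n) x≈y
      ; u-nat  = λ f g x n → proj₂ (unfold-invariants n) f g x
      }

  oSeq-isFinal : IsFinal oSeq oSeqξ
  oSeq-isFinal A _ ξA A-isCoalg =
    unfold , unfold-isNat , unfold-isCoalgHom ,
    λ v _ v-isCoalgHom x n → coalgHom-unique unfold v unfold-isCoalgHom v-isCoalgHom n x
    where open Unfold A ξA A-isCoalg

theorem6p18 : (C : SymMonCat) → Theory.Productive C →
    Σ (Theory.IsProfunctor C (Theory.oSeq C)) λ _ →
      Theory.IsCoalg C (Theory.oSeq C) (Theory.oSeqξ C) ×
      Theory.IsFinal C (Theory.oSeq C) (Theory.oSeqξ C)
theorem6p18 C productive = oSeq-isProfunctor , oSeq-isCoalg productive , oSeq-isFinal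
  where open ObservationalSequences C
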